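{- Let $n\ge 2$ be an integer, let $A,B,C,D$ be the blocks and $R_3(n)$ the region defined in the context. Then: (i) no unit cube location (location label) belongs to two different blocks among $A,B,C,D$; i.e. the blocks intersect at most trivially, along common boundary faces of adjacent unit cubes; (ii) every unit cube sized location of $R_3(n)$ is occupied by a unit cube of $A\cup B\cup C\cup D$, except for the locations with labels in the set $V=\{(i+1,1,z,w): 1\le i\le n,\ z,w\in\{1,\dots,i\}\}$ (located at $y=1$), which are unoccupied; $V$ has $1^2+2^2+\cdots+n^2$ elements, and for each $(x,1,z,w)\in V$ the unit cube with label $(x,2,z,w)$ belongs to $C$ (and conversely each unit cube of $C$ with $y=2$ is adjacent in this way to a location in $V$); (iii) every unit cube of $A\cup B\cup C\cup D$ lies in $R_3(n)$ except for the unit cubes of $D$ whose label has $z=0$; these form an overhang layer of $1^2+2^2+\cdots+n^2$ unit cubes lying outside $R_3(n)$.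
   Context: Coordinates on $\mathbb{R}^4$ are $(x,y,z,w)$. For integers $a,b,c,d$, the unit cube (or unit cube sized location) with location label $(a,b,c,d)$ is the set $\{(x,y,z,w): a-1\le x\le a,\ b-1\le y\le b,\ c-1\le z\le c,\ d-1\le w\le d\}$. For a fixed integer $n\ge 2$, the blocks are the unions of the unit cubes with labels in the following sets: $A=\{(x,y,z,w): 1\le i\le n,\ z=i,\ x,y,w\in\{1,\dots,i\}\}$; $B=\{(x,y,z,w): 1\le i\le n,\ y=i+1,\ x,z,w\in\{1,\dots,i\}\}$; $C=\{(x,y,z,w): 1\le i\le n,\ x=i+1,\ y\in\{2,\dots,i+1\},\ z,w\in\{1,\dots,i\}\}$; $D=\{(x,y,z,w): 1\le i\le n,\ w=i,\ x,y\in\{1,\dots,i\},\ z\in\{0,\dots,i-1\}\}$. The region $R_3(n)$ is the union of the unit cube sized locations with labels $(x,y,z,w)$ satisfying $x,y\in\{1,\dots,n+1\}$ and $z,w\in\{1,\dots,n\}$; its volume is $n^2(n+1)^2$. -}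

module Defs where

open import Data.Nat using (ℕ; zero; suc; _+_; _*_; _≤_; _<_)
open import Data.Product using (Σ; _×_; _,_)
open import Data.Sum using (_⊎_)
open import Relation.Binary.PropositionalEquality using (_≡_)
open import Relation.Nullary using (¬_)

-- Location labels (x , y , z , w).  All labels occurring in the blocks and in
-- R₃(n) have non-negative coordinates, so ℕ suffices.
Label : Set
Label = ℕ × ℕ × ℕ × ℕ

_∈[_,_] : ℕ → ℕ → ℕ → Set
a ∈[ lo , hi ] = lo ≤ a × a ≤ hi

InA : ℕ → Label → Set
InA n (x , y , z , w) =
  Σ ℕ λ i → i ∈[ 1 , n ] × z ≡ i × x ∈[ 1 , i ] × y ∈[ 1 , i ] × w ∈[ 1 , i ]

InB : ℕ → Label → Set
InB n (x , y , z , w) =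
  Σ ℕ λ i → i ∈[ 1 , n ] × y ≡ suc i × x ∈[ 1 , i ] × z ∈[ 1 , i ] × w ∈[ 1 , i ]

InC : ℕ → Label → Set
InC n (x , y , z , w) =
  Σ ℕ λ i → i ∈[ 1 , n ] × x ≡ suc i × y ∈[ 2 , suc i ] × z ∈[ 1 , i ] × w ∈[ 1 , i ]

InD : ℕ → Label → Set
InD n (x , y , z , w) =
  Σ ℕ λ i → i ∈[ 1 , n ] × w ≡ i × x ∈[ 1 , i ] × y ∈[ 1 , i ] × z < i

Occupied : ℕ → Label → Set
Occupied n p = InA n p ⊎ InB n p ⊎ InC n p ⊎ InD n p

InR : ℕ → Label → Set
InR n (x , y , z , w) =
  x ∈[ 1 , suc n ] × y ∈[ 1 , suc n ] × z ∈[ 1 , n ] × w ∈[ 1 , n ]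

InV : ℕ → Label → Set
InV n (x , y , z , w) =
  Σ ℕ λ i → i ∈[ 1 , n ] × x ≡ suc i × y ≡ 1 × z ∈[ 1 , i ] × w ∈[ 1 , i ]

zOf : Label → ℕ
zOf (x , y , z , w) = z

sumSq : ℕ → ℕ
sumSq zero    = 0
sumSq (suc n) = sumSq n + suc n * suc n

{-# OPTIONS --safe #-}

-- Every location has a unique leading coordinate, and every cube of A, B, C
-- or D is led by z, y, x or w respectively, so the blocks are disjoint.
-- Conversely, within R₃(n) the locations led by z, y and w are exactly A, B
-- and D, and those led by x are C when y ≥ 2 and form V when y = 1.  Every
-- block lies in R₃(n) except the layer z = 0 of D, and
-- (x , y , 0 , i) ↦ (i+1 , 1 , x , y) matches this overhang with V, a pyramid
-- of squares 1², …, n².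

module Submission where

open import Defs
open import Data.Nat using (ℕ; zero; suc; _*_; _≤_; _<_; z≤n; s≤s)
open import Data.Nat.Properties
  using (≤-refl; ≤-trans; <⇒≤; <⇒≱; ≤-<-connex;
         ≤-pred; ≤-antisym; ≮⇒≥; _<?_; <-irrelevant; ≡-irrelevant;
         n≮n; n<1+n; m<n⇒m<1+n; m≤n⇒m≤1+n)
open import Data.Fin using (Fin; toℕ; fromℕ<)
open import Data.Fin.Properties using (toℕ<n; toℕ-fromℕ<; fromℕ<-toℕ; +↔⊎; *↔×)
open import Data.Product using (Σ; _×_; _,_)
open import Data.Sum using (_⊎_; inj₁; inj₂)
open import Relation.Binary.PropositionalEquality using (_≡_; refl; cong; subst)
open import Relation.Nullary using (¬_; yes; no; contradiction)
open import Function.Bundles using (_↔_; mk↔ₛ′)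
open import Function.Properties.Inverse using (↔-refl; ↔-trans)
open import Function.Related.Propositional using (module EquationalReasoning; bijection)
open import Data.Sum.Function.Propositional using (_⊎-↔_)
open import Data.Product.Function.NonDependent.Propositional using (_×-↔_)

Below : ℕ → Set
Below m = Σ ℕ (_< m)

Below-≡ : ∀ {m a b} {a<m : a < m} {b<m : b < m} → a ≡ b → (a , a<m) ≡ (b , b<m)
Below-≡ refl = cong (_ ,_) (<-irrelevant _ _)

Below↔Fin : ∀ m → Below m ↔ Fin m
Below↔Fin m = mk↔ₛ′ (λ (a , a<m) → fromℕ< a<m) (λ i → toℕ i , toℕ<n i)
  (λ i → fromℕ<-toℕ i (toℕ<n i)) (λ (a , a<m) → Below-≡ (toℕ-fromℕ< a<m))

ΣBelow : ℕ → (ℕ → Set) → Set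
ΣBelow n F = Σ ℕ λ k → k < n × F k

ΣBelow-suc↔ : ∀ n (F : ℕ → Set) → ΣBelow (suc n) F ↔ (ΣBelow n F ⊎ F n)
ΣBelow-suc↔ n F = mk↔ₛ′ split join split∘join join∘split
  where
  top : ∀ {k} → k < suc n → ¬ k < n → k ≡ n
  top k<1+n k≮n = ≤-antisym (≤-pred k<1+n) (≮⇒≥ k≮n)

  split : ΣBelow (suc n) F → ΣBelow n F ⊎ F n
  split (k , k<1+n , f) with k <? n
  ... | yes k<n = inj₁ (k , k<n , f)
  ... | no  k≮n = inj₂ (subst F (top k<1+n k≮n) f)

  join : ΣBelow n F ⊎ F n → ΣBelow (suc n) F
  join (inj₁ (k , k<n , f)) = k , m<n⇒m<1+n k<n , f
  join (inj₂ f)             = n , n<1+n n , f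

  split∘join : ∀ x → split (join x) ≡ x
  split∘join (inj₁ (k , k<n , f)) with k <? n
  ... | yes k<n′ = cong (λ k<n → inj₁ (k , k<n , f)) (<-irrelevant k<n′ k<n)
  ... | no  k≮n  = contradiction k<n k≮n
  split∘join (inj₂ f) with n <? n
  ... | yes n<n = contradiction n<n (n≮n n)
  ... | no  _   = cong (λ e → inj₂ (subst F e f)) (≡-irrelevant _ refl)

  join-top : ∀ {k} (e : k ≡ n) (k<1+n : k < suc n) f →
             (n , n<1+n n , subst F e f) ≡ (k , k<1+n , f)
  join-top refl k<1+n f = cong (λ k<1+n → n , k<1+n , f) (<-irrelevant _ _)

  join∘split : ∀ x → join (split x) ≡ x
  join∘split (k , k<1+n , f) with k <? n
  ... | yes k<n = cong (λ k<1+n → k , k<1+n , f) (<-irrelevant _ _)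
  ... | no  k≮n = join-top (top k<1+n k≮n) k<1+n f

Pyramid : ℕ → Set
Pyramid n = ΣBelow n λ k → Below (suc k) × Below (suc k)

Pyramid↔Fin : ∀ n → Pyramid n ↔ Fin (sumSq n)
Pyramid↔Fin zero = mk↔ₛ′ (λ ()) (λ ()) (λ ()) (λ ())
Pyramid↔Fin (suc n) = begin
  Pyramid (suc n)                                ↔⟨ ΣBelow-suc↔ n _ ⟩
  (Pyramid n ⊎ (Below (suc n) × Below (suc n)))
    ↔⟨ Pyramid↔Fin n ⊎-↔ (Below↔Fin _ ×-↔ Below↔Fin _) ⟩
  (Fin (sumSq n) ⊎ (Fin (suc n) × Fin (suc n)))  ↔⟨ ↔-refl ⊎-↔ *↔× ⟨
  (Fin (sumSq n) ⊎ Fin (suc n * suc n))          ↔⟨ +↔⊎ ⟨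
  Fin (sumSq (suc n))                            ∎
  where open EquationalReasoning {k = bijection}

-- Ties are broken in the order z, w, x, y.
MaxZ MaxY MaxX MaxW : Label → Set
MaxZ (x , y , z , w) = x ≤ z × y ≤ z × w ≤ z
MaxY (x , y , z , w) = x < y × z < y × w < y
MaxX (x , y , z , w) = y ≤ x × z < x × w < x
MaxW (x , y , z , w) = x ≤ w × y ≤ w × z < w

max-cases-xy≤w : ∀ {x y z w} → x ≤ w → y ≤ w →
  let p = (x , y , z , w) in MaxZ p ⊎ MaxY p ⊎ MaxX p ⊎ MaxW p
max-cases-xy≤w {z = z} {w} x≤w y≤w with ≤-<-connex w z
... | inj₁ w≤z = inj₁ (≤-trans x≤w w≤z , ≤-trans y≤w w≤z , w≤z)
... | inj₂ z<w = inj₂ (inj₂ (inj₂ (x≤w , y≤w , z<w)))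

max-cases : ∀ p → MaxZ p ⊎ MaxY p ⊎ MaxX p ⊎ MaxW p
max-cases (x , y , z , w) with ≤-<-connex y x
max-cases (x , y , z , w) | inj₁ y≤x with ≤-<-connex x w
... | inj₁ x≤w = max-cases-xy≤w x≤w (≤-trans y≤x x≤w)
... | inj₂ w<x with ≤-<-connex x z
...   | inj₁ x≤z = inj₁ (x≤z , ≤-trans y≤x x≤z , ≤-trans (<⇒≤ w<x) x≤z)
...   | inj₂ z<x = inj₂ (inj₂ (inj₁ (y≤x , z<x , w<x)))
max-cases (x , y , z , w) | inj₂ x<y with ≤-<-connex y w
... | inj₁ y≤w = max-cases-xy≤w (≤-trans (<⇒≤ x<y) y≤w) y≤w
... | inj₂ w<y with ≤-<-connex y z
...   | inj₁ y≤z = inj₁ (≤-trans (<⇒≤ x<y) y≤z , y≤z , ≤-trans (<⇒≤ w<y) y≤z)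
...   | inj₂ z<y = inj₂ (inj₁ (x<y , z<y , w<y))

InA⇒MaxZ : ∀ {n} p → InA n p → MaxZ p
InA⇒MaxZ _ (_ , _ , refl , (_ , x≤i) , (_ , y≤i) , (_ , w≤i)) = x≤i , y≤i , w≤i

InB⇒MaxY : ∀ {n} p → InB n p → MaxY p
InB⇒MaxY _ (_ , _ , refl , (_ , x≤i) , (_ , z≤i) , (_ , w≤i)) = s≤s x≤i , s≤s z≤i , s≤s w≤i

InC⇒MaxX : ∀ {n} p → InC n p → MaxX p
InC⇒MaxX _ (_ , _ , refl , (_ , y≤1+i) , (_ , z≤i) , (_ , w≤i)) = y≤1+i , s≤s z≤i , s≤s w≤i

InD⇒MaxW : ∀ {n} p → InD n p → MaxW p
InD⇒MaxW _ (_ , _ , refl , (_ , x≤i) , (_ , y≤i) , z<i) = x≤i , y≤i , z<i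

InV⇒MaxX : ∀ {n} p → InV n p → MaxX p
InV⇒MaxX _ (_ , _ , refl , refl , (_ , z≤i) , (_ , w≤i)) = s≤s z≤n , s≤s z≤i , s≤s w≤i

MaxZ⇒¬MaxY : ∀ p → MaxZ p → ¬ MaxY p
MaxZ⇒¬MaxY _ (_ , y≤z , _) (_ , z<y , _) = <⇒≱ z<y y≤z

MaxZ⇒¬MaxX : ∀ p → MaxZ p → ¬ MaxX p
MaxZ⇒¬MaxX _ (x≤z , _ , _) (_ , z<x , _) = <⇒≱ z<x x≤z

MaxZ⇒¬MaxW : ∀ p → MaxZ p → ¬ MaxW p
MaxZ⇒¬MaxW _ (_ , _ , w≤z) (_ , _ , z<w) = <⇒≱ z<w w≤z

MaxY⇒¬MaxX : ∀ p → MaxY p → ¬ MaxX p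
MaxY⇒¬MaxX _ (x<y , _ , _) (y≤x , _ , _) = <⇒≱ x<y y≤x

MaxY⇒¬MaxW : ∀ p → MaxY p → ¬ MaxW p
MaxY⇒¬MaxW _ (_ , _ , w<y) (_ , y≤w , _) = <⇒≱ w<y y≤w

MaxX⇒¬MaxW : ∀ p → MaxX p → ¬ MaxW p
MaxX⇒¬MaxW _ (_ , _ , w<x) (x≤w , _ , _) = <⇒≱ w<x x≤w

MaxZ⇒InA : ∀ {n} p → InR n p → MaxZ p → InA n p
MaxZ⇒InA (_ , _ , z , _) ((1≤x , _) , (1≤y , _) , z∈ , (1≤w , _)) (x≤z , y≤z , w≤z) =
  z , z∈ , refl , (1≤x , x≤z) , (1≤y , y≤z) , (1≤w , w≤z)

MaxY⇒InB : ∀ {n} p → InR n p → MaxY p → InB n p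
MaxY⇒InB (_ , suc i , _ , _) ((1≤x , _) , (_ , s≤s i≤n) , (1≤z , _) , (1≤w , _))
         (s≤s x≤i , s≤s z≤i , s≤s w≤i) =
  i , (≤-trans 1≤z z≤i , i≤n) , refl , (1≤x , x≤i) , (1≤z , z≤i) , (1≤w , w≤i)

MaxX⇒InC⊎InV : ∀ {n} p → InR n p → MaxX p → InC n p ⊎ InV n p
MaxX⇒InC⊎InV (_ , zero , _ , _) (_ , (() , _) , _) _
MaxX⇒InC⊎InV (suc i , 1 , _ , _) ((_ , s≤s i≤n) , _ , (1≤z , _) , (1≤w , _))
             (_ , s≤s z≤i , s≤s w≤i) =
  inj₂ (i , (≤-trans 1≤z z≤i , i≤n) , refl , refl , (1≤z , z≤i) , (1≤w , w≤i))
MaxX⇒InC⊎InV (suc i , suc (suc _) , _ , _) ((_ , s≤s i≤n) , _ , (1≤z , _) , (1≤w , _))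
             (y≤1+i , s≤s z≤i , s≤s w≤i) =
  inj₁ (i , (≤-trans 1≤z z≤i , i≤n) , refl , (s≤s (s≤s z≤n) , y≤1+i) ,
        (1≤z , z≤i) , (1≤w , w≤i))

MaxW⇒InD : ∀ {n} p → InR n p → MaxW p → InD n p
MaxW⇒InD (_ , _ , _ , w) ((1≤x , _) , (1≤y , _) , _ , w∈) (x≤w , y≤w , z<w) =
  w , w∈ , refl , (1≤x , x≤w) , (1≤y , y≤w) , z<w

InA⇒InR : ∀ {n} p → InA n p → InR n p
InA⇒InR _ (_ , i∈@(_ , i≤n) , refl , (1≤x , x≤i) , (1≤y , y≤i) , (1≤w , w≤i)) =
  (1≤x , m≤n⇒m≤1+n (≤-trans x≤i i≤n)) , (1≤y , m≤n⇒m≤1+n (≤-trans y≤i i≤n)) ,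
  i∈ , (1≤w , ≤-trans w≤i i≤n)

InB⇒InR : ∀ {n} p → InB n p → InR n p
InB⇒InR _ (_ , (_ , i≤n) , refl , (1≤x , x≤i) , (1≤z , z≤i) , (1≤w , w≤i)) =
  (1≤x , m≤n⇒m≤1+n (≤-trans x≤i i≤n)) , (s≤s z≤n , s≤s i≤n) ,
  (1≤z , ≤-trans z≤i i≤n) , (1≤w , ≤-trans w≤i i≤n)

InC⇒InR : ∀ {n} p → InC n p → InR n p
InC⇒InR _ (_ , (_ , i≤n) , refl , (2≤y , y≤1+i) , (1≤z , z≤i) , (1≤w , w≤i)) =
  (s≤s z≤n , s≤s i≤n) , (≤-trans (s≤s z≤n) 2≤y , ≤-trans y≤1+i (s≤s i≤n)) ,
  (1≤z , ≤-trans z≤i i≤n) , (1≤w , ≤-trans w≤i i≤n)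

Overhang : ℕ → Label → Set
Overhang n p = InD n p × zOf p ≡ 0

InD⇒InR⊎Overhang : ∀ {n} p → InD n p → InR n p ⊎ Overhang n p
InD⇒InR⊎Overhang (_ , _ , zero , _) d = inj₂ (d , refl)
InD⇒InR⊎Overhang (_ , _ , suc _ , _)
                 (_ , i∈@(_ , i≤n) , refl , (1≤x , x≤i) , (1≤y , y≤i) , z<i) =
  inj₁ ((1≤x , m≤n⇒m≤1+n (≤-trans x≤i i≤n)) , (1≤y , m≤n⇒m≤1+n (≤-trans y≤i i≤n)) ,
        (s≤s z≤n , ≤-trans (<⇒≤ z<i) i≤n) , i∈)

Overhang⇒¬InR : ∀ {n} p → Overhang n p → ¬ InR n p
Overhang⇒¬InR _ (_ , refl) (_ , _ , (() , _) , _)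

Occupied⇒InR⊎Overhang : ∀ n p → Occupied n p → InR n p ⊎ Overhang n p
Occupied⇒InR⊎Overhang _ p (inj₁ a)               = inj₁ (InA⇒InR p a)
Occupied⇒InR⊎Overhang _ p (inj₂ (inj₁ b))        = inj₁ (InB⇒InR p b)
Occupied⇒InR⊎Overhang _ p (inj₂ (inj₂ (inj₁ c))) = inj₁ (InC⇒InR p c)
Occupied⇒InR⊎Overhang _ p (inj₂ (inj₂ (inj₂ d))) = InD⇒InR⊎Overhang p d

blocks-disjoint : ∀ n p →
    ¬ (InA n p × InB n p) × ¬ (InA n p × InC n p) × ¬ (InA n p × InD n p)
  × ¬ (InB n p × InC n p) × ¬ (InB n p × InD n p) × ¬ (InC n p × InD n p)
blocks-disjoint n p =
    (λ (a , b) → MaxZ⇒¬MaxY p (InA⇒MaxZ p a) (InB⇒MaxY p b))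
  , (λ (a , c) → MaxZ⇒¬MaxX p (InA⇒MaxZ p a) (InC⇒MaxX p c))
  , (λ (a , d) → MaxZ⇒¬MaxW p (InA⇒MaxZ p a) (InD⇒MaxW p d))
  , (λ (b , c) → MaxY⇒¬MaxX p (InB⇒MaxY p b) (InC⇒MaxX p c))
  , (λ (b , d) → MaxY⇒¬MaxW p (InB⇒MaxY p b) (InD⇒MaxW p d))
  , (λ (c , d) → MaxX⇒¬MaxW p (InC⇒MaxX p c) (InD⇒MaxW p d))

InR⇒Occupied⊎InV : ∀ n p → InR n p → Occupied n p ⊎ InV n p
InR⇒Occupied⊎InV n p r with max-cases p
... | inj₁ z               = inj₁ (inj₁ (MaxZ⇒InA p r z))
... | inj₂ (inj₁ y)        = inj₁ (inj₂ (inj₁ (MaxY⇒InB p r y)))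
... | inj₂ (inj₂ (inj₂ w)) = inj₁ (inj₂ (inj₂ (inj₂ (MaxW⇒InD p r w))))
... | inj₂ (inj₂ (inj₁ x)) with MaxX⇒InC⊎InV p r x
...   | inj₁ c = inj₁ (inj₂ (inj₂ (inj₁ c)))
...   | inj₂ v = inj₂ v

InR∖V⇒Occupied : ∀ n p → InR n p → ¬ InV n p → Occupied n p
InR∖V⇒Occupied n p r p∉V with InR⇒Occupied⊎InV n p r
... | inj₁ o = o
... | inj₂ v = contradiction v p∉V

InV⇒¬Occupied : ∀ {n} p → InV n p → ¬ Occupied n p
InV⇒¬Occupied p v (inj₁ a)               = MaxZ⇒¬MaxX p (InA⇒MaxZ p a) (InV⇒MaxX p v)
InV⇒¬Occupied p v (inj₂ (inj₁ b))        = MaxY⇒¬MaxX p (InB⇒MaxY p b) (InV⇒MaxX p v)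
InV⇒¬Occupied p v (inj₂ (inj₂ (inj₂ d))) = MaxX⇒¬MaxW p (InV⇒MaxX p v) (InD⇒MaxW p d)
InV⇒¬Occupied _ (_ , _ , _ , refl , _) (inj₂ (inj₂ (inj₁ (_ , _ , _ , (s≤s () , _) , _))))

InV⇒InR : ∀ {n} p → InV n p → InR n p
InV⇒InR _ (_ , (_ , i≤n) , refl , refl , (1≤z , z≤i) , (1≤w , w≤i)) =
  (s≤s z≤n , s≤s i≤n) , (s≤s z≤n , s≤s z≤n) , (1≤z , ≤-trans z≤i i≤n) , (1≤w , ≤-trans w≤i i≤n)

InV⇒InC-above : ∀ {n} x z w → InV n (x , 1 , z , w) → InC n (x , 2 , z , w)
InV⇒InC-above _ _ _ (i , i∈@(1≤i , _) , refl , _ , z∈ , w∈) =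
  i , i∈ , refl , (≤-refl , s≤s 1≤i) , z∈ , w∈

InC-above⇒InV : ∀ {n} x z w → InC n (x , 2 , z , w) → InV n (x , 1 , z , w)
InC-above⇒InV _ _ _ (i , i∈ , refl , _ , z∈ , w∈) = i , i∈ , refl , refl , z∈ , w∈

V↔Pyramid : ∀ n → Σ Label (InV n) ↔ Pyramid n
V↔Pyramid n = mk↔ₛ′ to from (λ _ → refl) from∘to
  where
  to : Σ Label (InV n) → Pyramid n
  to ((_ , _ , suc a , suc b) ,
      suc k , (_ , k<n) , refl , refl , (_ , a<1+k) , (_ , b<1+k)) =
    k , k<n , (a , a<1+k) , (b , b<1+k)

  from : Pyramid n → Σ Label (InV n)
  from (k , k<n , (a , a<1+k) , (b , b<1+k)) =
    (suc (suc k) , 1 , suc a , suc b) ,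
    suc k , (s≤s z≤n , k<n) , refl , refl , (s≤s z≤n , a<1+k) , (s≤s z≤n , b<1+k)

  from∘to : ∀ v → from (to v) ≡ v
  from∘to ((_ , _ , suc _ , suc _) ,
           suc _ , (s≤s z≤n , _) , refl , refl , (s≤s z≤n , _) , (s≤s z≤n , _)) = refl

Overhang↔V : ∀ n → Σ Label (Overhang n) ↔ Σ Label (InV n)
Overhang↔V n = mk↔ₛ′ to from to∘from from∘to
  where
  to : Σ Label (Overhang n) → Σ Label (InV n)
  to ((x , y , _ , _) , (i , i∈ , refl , x∈ , y∈ , _) , refl) =
    (suc i , 1 , x , y) , i , i∈ , refl , refl , x∈ , y∈

  from : Σ Label (InV n) → Σ Label (Overhang n)
  from ((_ , _ , z , w) , i , i∈@(1≤i , _) , refl , refl , z∈ , w∈) =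
    (z , w , 0 , i) , (i , i∈ , refl , z∈ , w∈ , 1≤i) , refl

  to∘from : ∀ v → to (from v) ≡ v
  to∘from (_ , _ , _ , refl , refl , _ , _) = refl

  from∘to : ∀ d → from (to d) ≡ d
  from∘to (_ , (suc _ , (s≤s z≤n , _) , refl , _ , _ , s≤s z≤n) , refl) = refl

theorem7 : (n : ℕ) → 2 ≤ n →
    -- (i) pairwise disjointness of the blocks (as sets of locations)
    ((p : Label) →
        ¬ (InA n p × InB n p) × ¬ (InA n p × InC n p) × ¬ (InA n p × InD n p)
      × ¬ (InB n p × InC n p) × ¬ (InB n p × InD n p) × ¬ (InC n p × InD n p))
    -- (ii) R₃(n) is filled except exactly at V, V ⊆ R₃(n) unoccupied,
    --      |V| = 1² + ⋯ + n², and V is adjacent to the y = 2 layer of C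
    × ((p : Label) → InR n p → ¬ InV n p → Occupied n p)
    × ((p : Label) → InV n p → InR n p × ¬ Occupied n p)
    × (Σ Label (InV n) ↔ Fin (sumSq n))
    × ((x z w : ℕ) → InV n (x , 1 , z , w) → InC n (x , 2 , z , w))
    × ((x z w : ℕ) → InC n (x , 2 , z , w) → InV n (x , 1 , z , w))
    -- (iii) every occupied cube lies in R₃(n) except the D-cubes with z = 0,
    --       which lie outside R₃(n) and number 1² + ⋯ + n²
    × ((p : Label) → Occupied n p → InR n p ⊎ (InD n p × zOf p ≡ 0))
    × ((p : Label) → InD n p → zOf p ≡ 0 → ¬ InR n p)
    × (Σ Label (λ p → InD n p × zOf p ≡ 0) ↔ Fin (sumSq n))
-- The construction works for every n.
theorem7 n _ =
    blocks-disjoint n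
  , InR∖V⇒Occupied n
  , (λ p v → InV⇒InR p v , InV⇒¬Occupied p v)
  , V↔Fin
  , InV⇒InC-above
  , InC-above⇒InV
  , Occupied⇒InR⊎Overhang n
  , (λ p d z≡0 → Overhang⇒¬InR p (d , z≡0))
  , ↔-trans (Overhang↔V n) V↔Fin
  where
  V↔Fin : Σ Label (InV n) ↔ Fin (sumSq n)
  V↔Fin = ↔-trans (V↔Pyramid n) (Pyramid↔Fin n)
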